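{- Let $n\ge 2$ and let $C$ be a mutation cycle of $n$-vertex quivers, based at $Q$ with mutation sequence $i_1,\dots,i_N$, such that every quiver along the cycle has large weights. Then $C$ does not underlie a mutation cycle of seeds in the associated cluster algebra, with arbitrary coefficients: for any seed $(\mathbf{x},\mathbf{y},B(Q))$, applying the seed mutations $\mu_{i_1},\dots,\mu_{i_N}$ in this order does not return the same seed. In particular, for $n\ge4$, $k>0$, a quiver $\tilde R$ on $[1,n-1]$ with $b_{ij}(\tilde R)\ge 2$ for $i<j$, and $Q$ the quiver on $[1,n]$ whose full subquiver on $[1,n-1]$ is obtained from $\tilde R$ by mutating successively at $2,1,\dots,2,1$ ($2k$ mutations, starting with $2$) and with arbitrary $b_{in}(Q)\ge 2$, the mutation cycle based at $Q$ given by mutating successively at $n,\ 1,2,\dots,1,2\ (2k\text{ terms}),\ n-1,\dots,2,1,\ 2,1,\dots,2,1\ (2k\text{ terms})$ is never a mutation cycle of seeds.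
   Context: A quiver on $[1,n]$ is a finite directed multigraph with no loops and no oriented 2-cycles, encoded by the skew-symmetric matrix $B(Q)=(b_{ij})$; matrix mutation at $k$: $b'_{ij}=-b_{ij}$ if $k\in\{i,j\}$, else $b'_{ij}=b_{ij}+\tfrac12(|b_{ik}|b_{kj}+b_{ik}|b_{kj}|)$. $Q$ has large weights if $|b_{ij}|\ge 2$ for all $i\ne j$. A mutation cycle of length $N$ based at $Q$ is a sequence $i_1,\dots,i_N$ with consecutive entries distinct (cyclically), no mutation at an isolated vertex, such that successive mutations at $i_1,\dots,i_N$ return $Q$. Seeds with arbitrary coefficients: fix a semifield $(\mathbb{P},\oplus,\cdot)$ and a field $\mathcal F$ of rational functions in $n$ variables over the field of fractions of $\mathbb{Z}\mathbb{P}$. A seed is a triple $(\mathbf{x},\mathbf{y},B)$ with $\mathbf{x}=(x_1,\dots,x_n)$ a free generating set of $\mathcal F$, $\mathbf{y}=(y_1,\dots,y_n)\in\mathbb{P}^n$, $B$ skew-symmetric. Seed mutation $\mu_k$ replaces $B$ by its matrix mutation, replaces $x_k$ by $x_k'=\dfrac{y_k\prod_i x_i^{[b_{ik}]_+}+\prod_i x_i^{[-b_{ik}]_+}}{(y_k\oplus 1)\,x_k}$ (other $x_j$ unchanged), and replaces $y_j$ by $y_k^{ -1}$ if $j=k$ and by $y_jy_k^{[b_{kj}]_+}(y_k\oplus1)^{ -b_{kj}}$ otherwise, where $[t]_+=\max(t,0)$. Two seeds are the same if their clusters coincide as labeled tuples and the coefficient tuples and matrices coincide. -}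

module Defs where

open import Level using (Level; _⊔_) renaming (suc to lsuc)
open import Data.Nat as ℕ using (ℕ; zero; suc)
open import Data.Integer as ℤ using (ℤ; +_; -[1+_]; ∣_∣)
open import Data.Integer.DivMod using (_/_)
open import Data.Fin using (Fin; zero; suc; inject₁; fromℕ; _<_)
open import Data.Fin.Properties using (_≟_)
open import Data.List using (List; []; _∷_; _++_; foldr; foldl; map; allFin; concat; replicate; reverse)
open import Data.Product using (_×_; _,_; Σ; ∃)
open import Data.Unit using (⊤)
open import Data.Empty using (⊥)
open import Relation.Nullary using (¬_; yes; no)
open import Relation.Binary.PropositionalEquality using (_≡_; _≢_)
open import Relation.Binary.Core using (Rel)
open import Algebra.Core using (Op₁; Op₂)
open import Algebra.Structures using (IsAbelianGroup)

record Semifield (c ℓ : Level) : Set (lsuc (c ⊔ ℓ)) where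
  infixl 7 _·_
  infixl 6 _⊕_
  infix 4 _≈_
  field
    Carrier : Set c
    _≈_ : Rel Carrier ℓ
    _·_ : Op₂ Carrier
    1# : Carrier
    _⁻¹ : Op₁ Carrier
    _⊕_ : Op₂ Carrier
    isAbelianGroup : IsAbelianGroup _≈_ _·_ 1# _⁻¹
    ⊕-cong : ∀ {a b a' b'} → a ≈ a' → b ≈ b' → (a ⊕ b) ≈ (a' ⊕ b')
    ⊕-assoc : ∀ a b d → ((a ⊕ b) ⊕ d) ≈ (a ⊕ (b ⊕ d))
    ⊕-comm : ∀ a b → (a ⊕ b) ≈ (b ⊕ a)
    distrib : ∀ a b d → (a · (b ⊕ d)) ≈ ((a · b) ⊕ (a · d))

  _^ℕ_ : Carrier → ℕ → Carrier
  a ^ℕ zero = 1#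
  a ^ℕ suc m = a · (a ^ℕ m)

  _^ℤ_ : Carrier → ℤ → Carrier
  a ^ℤ (+ m) = a ^ℕ m
  a ^ℤ -[1+ m ] = (a ^ℕ suc m) ⁻¹

-- Exchange matrices / quivers on [1,n] (vertices Fin n, 0-based)

Mat : ℕ → Set
Mat n = Fin n → Fin n → ℤ

SkewSym : ∀ {n} → Mat n → Set
SkewSym {n} B = ∀ i j → B j i ≡ ℤ.- B i j

pos : ℤ → ℕ
pos (+ m) = m
pos -[1+ m ] = 0

mutMat : ∀ {n} → Fin n → Mat n → Mat n
mutMat k B i j with i ≟ k | j ≟ k
... | yes _ | _ = ℤ.- B i j
... | no _ | yes _ = ℤ.- B i j
... | no _ | no _ =
  B i j ℤ.+ ((+ ∣ B i k ∣ ℤ.* B k j ℤ.+ B i k ℤ.* + ∣ B k j ∣) / + 2)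

mutMatSeq : ∀ {n} → List (Fin n) → Mat n → Mat n
mutMatSeq [] B = B
mutMatSeq (k ∷ ks) B = mutMatSeq ks (mutMat k B)

LargeWeights : ∀ {n} → Mat n → Set
LargeWeights B = ∀ i j → i ≢ j → 2 ℕ.≤ ∣ B i j ∣

Isolated : ∀ {n} → Mat n → Fin n → Set
Isolated B k = ∀ j → B j k ≡ + 0

ConsecDistinct : ∀ {n} → List (Fin n) → Set
ConsecDistinct [] = ⊤
ConsecDistinct (i ∷ []) = ⊤
ConsecDistinct (i ∷ j ∷ r) = i ≢ j × ConsecDistinct (j ∷ r)

NoIsolatedMut : ∀ {n} → Mat n → List (Fin n) → Set
NoIsolatedMut B [] = ⊤
NoIsolatedMut B (k ∷ ks) = ¬ Isolated B k × NoIsolatedMut (mutMat k B) ks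

AlongSeq : ∀ {n} → (Mat n → Set) → Mat n → List (Fin n) → Set
AlongSeq P B [] = P B
AlongSeq P B (k ∷ ks) = P B × AlongSeq P (mutMat k B) ks

IsMutationCycle : ∀ {n} → Mat n → List (Fin n) → Set
IsMutationCycle B [] = ⊥
IsMutationCycle B (i ∷ r) =
  ConsecDistinct (i ∷ r ++ i ∷ []) × NoIsolatedMut B (i ∷ r)
  × (∀ a b → mutMatSeq (i ∷ r) B a b ≡ B a b)

-- The ambient field F = Frac(ZP)(t₁,…,tₙ).
-- Expr: expressions for elements of the group ring ZP[t₁,…,tₙ];
-- _≈E_: the congruence presenting ZP[t] as a quotient of the free
-- commutative ring on symbols [p] (p ∈ P) and tᵢ.

module Field {c ℓ} (P : Semifield c ℓ) (n : ℕ) where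
  open Semifield P

  infixl 6 _+E_
  infixl 7 _*E_
  data Expr : Set c where
    con : Carrier → Expr
    var : Fin n → Expr
    0E 1E : Expr
    _+E_ _*E_ : Expr → Expr → Expr
    -E_ : Expr → Expr

  infix 4 _≈E_
  data _≈E_ : Expr → Expr → Set (c ⊔ ℓ) where
    ≈refl : ∀ {a} → a ≈E a
    ≈sym : ∀ {a b} → a ≈E b → b ≈E a
    ≈trans : ∀ {a b d} → a ≈E b → b ≈E d → a ≈E d
    +cong : ∀ {a b a' b'} → a ≈E a' → b ≈E b' → a +E b ≈E a' +E b'
    *cong : ∀ {a b a' b'} → a ≈E a' → b ≈E b' → a *E b ≈E a' *E b'
    -cong : ∀ {a a'} → a ≈E a' → -E a ≈E -E a'
    +assoc : ∀ a b d → (a +E b) +E d ≈E a +E (b +E d)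
    +comm : ∀ a b → a +E b ≈E b +E a
    +idʳ : ∀ a → a +E 0E ≈E a
    -invʳ : ∀ a → a +E (-E a) ≈E 0E
    *assoc : ∀ a b d → (a *E b) *E d ≈E a *E (b *E d)
    *comm : ∀ a b → a *E b ≈E b *E a
    *idʳ : ∀ a → a *E 1E ≈E a
    distribʳ : ∀ a b d → (a +E b) *E d ≈E (a *E d) +E (b *E d)
    con-cong : ∀ {p q} → p ≈ q → con p ≈E con q
    con-mul : ∀ p q → con (p · q) ≈E con p *E con q
    con-one : con 1# ≈E 1E

  -- elements of F: fractions num/den (den ≠ 0 for genuine elements)
  F : Set c
  F = Expr × Expr

  infix 4 _≈F_
  _≈F_ : F → F → Set (c ⊔ ℓ)
  (a , b) ≈F (a' , b') = a *E b' ≈E a' *E b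

  Valid : F → Set (c ⊔ ℓ)
  Valid (a , b) = ¬ (b ≈E 0E)

  0F 1F : F
  0F = 0E , 1E
  1F = 1E , 1E

  infixl 6 _+F_
  infixl 7 _*F_
  _+F_ _*F_ : F → F → F
  (a , b) +F (a' , b') = a *E b' +E a' *E b , b *E b'
  (a , b) *F (a' , b') = a *E a' , b *E b'

  invF : F → F
  invF (a , b) = b , a

  conF : Carrier → F
  conF p = con p , 1E

  _^F_ : F → ℕ → F
  f ^F zero = 1F
  f ^F suc m = f *F (f ^F m)

  prodF : (Fin n → F) → F
  prodF f = foldr _*F_ 1F (map f (allFin n))

  eval : (Fin n → F) → Expr → F
  eval x (con p) = conF p
  eval x (var i) = x i
  eval x 0E = 0F
  eval x 1E = 1F
  eval x (a +E b) = eval x a +F eval x b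
  eval x (a *E b) = eval x a *F eval x b
  eval x (-E a) = (-E proj₁' (eval x a)) , proj₂' (eval x a)
    where
    proj₁' proj₂' : F → Expr
    proj₁' (u , _) = u
    proj₂' (_ , v) = v

  -- x is a free generating set of F over K = Frac(ZP):
  -- its entries are elements of F, algebraically independent over K
  -- (equivalently over ZP), and they generate F as a field over K.
  record FreeGenerating (x : Fin n → F) : Set (c ⊔ ℓ) where
    field
      valid : ∀ i → Valid (x i)
      algIndep : ∀ e → eval x e ≈F 0F → e ≈E 0E
      generates : ∀ f → Valid f →
        Σ Expr λ a → Σ Expr λ b →
          (¬ (eval x b ≈F 0F)) × (f ≈F eval x a *F invF (eval x b))

  record Seed : Set c where
    constructor seed
    field
      cl : Fin n → F
      co : Fin n → Carrier
      mat : Mat n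

  mutSeed : Fin n → Seed → Seed
  mutSeed k (seed x y B) = seed x' y' (mutMat k B)
    where
    new : F
    new = (conF (y k) *F prodF (λ i → x i ^F pos (B i k))
           +F prodF (λ i → x i ^F pos (ℤ.- B i k)))
          *F invF (conF (y k ⊕ 1#) *F x k)
    x' : Fin n → F
    x' j with j ≟ k
    ... | yes _ = new
    ... | no _ = x j
    y' : Fin n → Carrier
    y' j with j ≟ k
    ... | yes _ = y k ⁻¹
    ... | no _ = y j · (y k ^ℕ pos (B k j)) · ((y k ⊕ 1#) ^ℤ (ℤ.- B k j))

  mutSeedSeq : List (Fin n) → Seed → Seed
  mutSeedSeq [] s = s
  mutSeedSeq (k ∷ ks) s = mutSeedSeq ks (mutSeed k s)

  SameSeed : Seed → Seed → Set (c ⊔ ℓ)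
  SameSeed (seed x y B) (seed x' y' B') =
    (∀ i → x i ≈F x' i) × (∀ i → y i ≈ y' i) × (∀ i j → B i j ≡ B' i j)

  NotSeedCycle : Mat n → List (Fin n) → Set (c ⊔ ℓ)
  NotSeedCycle B ks = ∀ (x : Fin n → F) → FreeGenerating x → (y : Fin n → Carrier) →
    ¬ SameSeed (mutSeedSeq ks (seed x y B)) (seed x y B)

-- The explicit family ("in particular" part), with n = 4 + p.
-- 0-based: vertex 1 ↦ zero, vertex 2 ↦ suc zero, vertex n ↦ fromℕ (3+p),
-- vertices in [1,n-1] ↦ inject₁ i.

rep21 rep12 : ∀ {m} → Fin (suc (suc m)) → Fin (suc (suc m)) → ℕ → List (Fin (suc (suc m)))
rep21 v1 v2 k = concat (replicate k (v2 ∷ v1 ∷ []))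
rep12 v1 v2 k = concat (replicate k (v1 ∷ v2 ∷ []))

specialSeq : (p k : ℕ) → List (Fin (suc (suc (suc (suc p)))))
specialSeq p k =
  fromℕ (suc (suc (suc p)))
  ∷ (rep12 zero (suc zero) k
     ++ reverse (map inject₁ (allFin (suc (suc (suc p)))))
     ++ rep21 zero (suc zero) k)

-- Put every coefficient and every initial cluster variable equal to 1.  The exchange relation
-- becomes x'ₖ = (∏ xᵢ^[bᵢₖ]₊ + ∏ xᵢ^[-bᵢₖ]₊) / xₖ on positive rationals, and along a mutation
-- sequence in which consecutive vertices j, k are distinct and joined by at least two arrows,
-- the last mutated value stays the strict maximum and above 1: one of the two monomials
-- contains x_j², so x'ₖ > x_j² / xₖ ≥ x_j.  Hence some cluster variable of the final seed is a
-- fraction U / V of polynomials with U(1,…,1) ≠ V(1,…,1).  If the seed came back, algebraic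
-- independence of the initial cluster would make U - tᵢ V vanish identically, which is
-- impossible.  Large weights give the adjacency condition for every mutation cycle; for the
-- explicit family it holds because n is a sink of Q, mutations at 1 and 2 only change signs
-- between 1 and 2, and n-1, …, 1 are successive sinks of R̃.

module Submission where

open import Defs
open import Level using (Level)
open import Data.Nat using (ℕ; suc; _≤_; _>_)
open import Data.Integer using (ℤ; +_) renaming (_≤_ to _≤ℤ_)
open import Data.Fin using (Fin; zero; suc; inject₁; fromℕ; _<_)
open import Data.List using (List)
open import Data.Product using (_×_)
open import Relation.Binary.PropositionalEquality using (_≡_)

open import Level using (_⊔_)
open import Algebra.Bundles using (CommutativeRing)
open import Data.Bool using (Bool; true; false; _xor_)
open import Data.Nat as ℕ using (zero; z≤n; s≤s; _*_; _+_)
import Data.Nat.Properties as ℕP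
import Data.Nat.DivMod as ℕD
open import Data.Nat.Tactic.RingSolver using (solve)
open import Data.Integer as ℤ using (-[1+_]; ∣_∣; +≤+)
open import Data.Integer.DivMod using (_/_)
import Data.Integer.Properties as ℤP
open import Data.Fin using (toℕ)
open import Data.Fin.Properties using (_≟_; inject₁-injective; toℕ-injective; toℕ<n; fromℕ≢inject₁)
open import Data.List using ([]; _∷_; _++_; foldr; map; reverse; allFin; downFrom; upTo; applyUpTo; tabulate)
import Data.List.Properties as List
open import Data.List.Membership.Propositional using (_∈_)
open import Data.List.Membership.Propositional.Properties using (∈-allFin)
open import Data.List.Relation.Unary.Any using (here; there)
open import Data.Product using (_,_; proj₁; proj₂; Σ; ∃)
open import Data.Sum using (_⊎_; inj₁; inj₂)
open import Data.Unit using (⊤; tt)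
open import Relation.Nullary using (¬_; yes; no; does; contradiction)
open import Relation.Nullary.Decidable using (dec-true; dec-false)
open import Relation.Binary.Definitions using (tri<; tri≈; tri>)
open import Relation.Binary.PropositionalEquality using (_≢_; refl; sym; trans; cong; cong₂; subst; subst₂; module ≡-Reasoning)

-- Matrix mutation

infix 4 _≐_
_≐_ : ∀ {n} → Mat n → Mat n → Set
B ≐ C = ∀ i j → B i j ≡ C i j

≐-trans : ∀ {n} {A B C : Mat n} → A ≐ B → B ≐ C → A ≐ C
≐-trans A≐B B≐C i j = trans (A≐B i j) (B≐C i j)

≐-sym : ∀ {n} {B C : Mat n} → B ≐ C → C ≐ B
≐-sym B≐C i j = sym (B≐C i j)

mutTerm : ℤ → ℤ → ℤ
mutTerm a b = (+ ∣ a ∣ ℤ.* b ℤ.+ a ℤ.* + ∣ b ∣) / + 2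

mutMat-cases : ∀ {n} k (B C : Mat n) →
  (∀ j → ℤ.- B k j ≡ C k j) →
  (∀ i → i ≢ k → ℤ.- B i k ≡ C i k) →
  (∀ i j → i ≢ k → j ≢ k → B i j ℤ.+ mutTerm (B i k) (B k j) ≡ C i j) →
  mutMat k B ≐ C
mutMat-cases k B C row col off i j with i ≟ k | j ≟ k
... | yes refl | _ = row j
... | no i≢k | yes refl = col i i≢k
... | no i≢k | no j≢k = off i j i≢k j≢k

mutMat-row : ∀ {n} k (B : Mat n) j → mutMat k B k j ≡ ℤ.- B k j
mutMat-row k B j with k ≟ k
... | yes _ = refl
... | no k≢k = contradiction refl k≢k

mutMat-col : ∀ {n} k (B : Mat n) i → mutMat k B i k ≡ ℤ.- B i k
mutMat-col k B i with i ≟ k | k ≟ k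
... | yes _ | _ = refl
... | no _ | yes _ = refl
... | no _ | no k≢k = contradiction refl k≢k

mutMat-off : ∀ {n} k (B : Mat n) {i j} → i ≢ k → j ≢ k → mutMat k B i j ≡ B i j ℤ.+ mutTerm (B i k) (B k j)
mutMat-off k B {i} {j} i≢k j≢k with i ≟ k | j ≟ k
... | yes i≡k | _ = contradiction i≡k i≢k
... | no _ | yes j≡k = contradiction j≡k j≢k
... | no _ | no _ = refl

mutMat-cong : ∀ {n} {B C : Mat n} k → B ≐ C → mutMat k B ≐ mutMat k C
mutMat-cong {B = B} {C} k B≐C =
  mutMat-cases k B (mutMat k C)
    (λ j → trans (cong ℤ.-_ (B≐C k j)) (sym (mutMat-row k C j)))
    (λ i _ → trans (cong ℤ.-_ (B≐C i k)) (sym (mutMat-col k C i)))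
    (λ i j i≢k j≢k → trans (cong₂ ℤ._+_ (B≐C i j) (cong₂ mutTerm (B≐C i k) (B≐C k j))) (sym (mutMat-off k C i≢k j≢k)))

mutMatSeq-cong : ∀ {n} (ks : List (Fin n)) {B C : Mat n} → B ≐ C → mutMatSeq ks B ≐ mutMatSeq ks C
mutMatSeq-cong [] B≐C = B≐C
mutMatSeq-cong (k ∷ ks) B≐C = mutMatSeq-cong ks (mutMat-cong k B≐C)

mutMatSeq-++ : ∀ {n} (ks ls : List (Fin n)) B → mutMatSeq (ks ++ ls) B ≡ mutMatSeq ls (mutMatSeq ks B)
mutMatSeq-++ [] ls B = refl
mutMatSeq-++ (k ∷ ks) ls B = mutMatSeq-++ ks ls (mutMat k B)

∣mutMat-row∣ : ∀ {n} k (B : Mat n) j → ∣ mutMat k B k j ∣ ≡ ∣ B k j ∣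
∣mutMat-row∣ k B j = trans (cong ∣_∣ (mutMat-row k B j)) (ℤP.∣-i∣≡∣i∣ (B k j))

∣mutMat-col∣ : ∀ {n} k (B : Mat n) i → ∣ mutMat k B i k ∣ ≡ ∣ B i k ∣
∣mutMat-col∣ k B i = trans (cong ∣_∣ (mutMat-col k B i)) (ℤP.∣-i∣≡∣i∣ (B i k))

double≡*2 : ∀ m → m ℕ.+ m ≡ m ℕ.* 2
double≡*2 m = sym (trans (ℕP.*-suc m 1) (cong (m ℕ.+_) (ℕP.*-identityʳ m)))

half-double : ∀ i → (i ℤ.+ i) / + 2 ≡ i
half-double (+ m) = trans (ℤP.*-identityˡ _) (cong +_ (trans (cong (ℕ._/ 2) (double≡*2 m)) (ℕD.m*n/n≡m m 2)))
half-double -[1+ m ] = trans (cong (λ k → -[1+ k ] / + 2) (cong ℕ.pred (trans (sym (ℕP.+-suc (suc m) m)) (double≡*2 (suc m))))) half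
  where
  even : suc m ℕ.* 2 ℕ.% 2 ≡ 0
  even = ℕD.m*n%n≡0 (suc m) 2
  half : -[1+ ℕ.pred (suc m ℕ.* 2) ] / + 2 ≡ -[1+ m ]
  half rewrite even = trans (ℤP.*-identityˡ _) (cong (λ k → ℤ.- (+ k)) (ℕD.m*n/n≡m (suc m) 2))

∣a∣b≡±a∣b∣ : ∀ a b → + ∣ a ∣ ℤ.* b ≡ a ℤ.* + ∣ b ∣ ⊎ + ∣ a ∣ ℤ.* b ≡ ℤ.- (a ℤ.* + ∣ b ∣)
∣a∣b≡±a∣b∣ (+ m) (+ n) = inj₁ refl
∣a∣b≡±a∣b∣ -[1+ m ] -[1+ n ] = inj₁ refl
∣a∣b≡±a∣b∣ (+ m) -[1+ n ] = inj₂ (sym (ℤP.neg-distribʳ-* (+ m) (+ suc n)))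
∣a∣b≡±a∣b∣ -[1+ m ] (+ n) = inj₂ (sym (ℤP.neg-distribˡ-* -[1+ m ] (+ n)))

mutTerm-opposite : ∀ m n → mutTerm (+ m) (ℤ.- + n) ≡ + 0
mutTerm-opposite m n = cong (_/ + 2) (begin
  + m ℤ.* ℤ.- + n ℤ.+ + m ℤ.* + ∣ ℤ.- + n ∣
    ≡⟨ cong₂ ℤ._+_ (sym (ℤP.neg-distribʳ-* (+ m) (+ n))) (cong (λ k → + m ℤ.* + k) (ℤP.∣-i∣≡∣i∣ (+ n))) ⟩
  ℤ.- (+ m ℤ.* + n) ℤ.+ + m ℤ.* + n       ≡⟨ ℤP.+-inverseˡ (+ m ℤ.* + n) ⟩
  + 0                                     ∎)
  where open ≡-Reasoning

mutTerm-neg : ∀ a b → mutTerm (ℤ.- a) (ℤ.- b) ≡ ℤ.- mutTerm a b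
mutTerm-neg a b = trans (cong (_/ + 2) numerator-neg) (cases (∣a∣b≡±a∣b∣ a b))
  where
  open ≡-Reasoning
  e = a ℤ.* + ∣ b ∣
  numerator-neg : + ∣ ℤ.- a ∣ ℤ.* ℤ.- b ℤ.+ ℤ.- a ℤ.* + ∣ ℤ.- b ∣ ≡ ℤ.- (+ ∣ a ∣ ℤ.* b) ℤ.+ ℤ.- e
  numerator-neg = cong₂ ℤ._+_
    (trans (cong (λ k → + k ℤ.* ℤ.- b) (ℤP.∣-i∣≡∣i∣ a)) (sym (ℤP.neg-distribʳ-* (+ ∣ a ∣) b)))
    (trans (cong (λ k → ℤ.- a ℤ.* + k) (ℤP.∣-i∣≡∣i∣ b)) (sym (ℤP.neg-distribˡ-* a (+ ∣ b ∣))))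
  cases : + ∣ a ∣ ℤ.* b ≡ e ⊎ + ∣ a ∣ ℤ.* b ≡ ℤ.- e →
          (ℤ.- (+ ∣ a ∣ ℤ.* b) ℤ.+ ℤ.- e) / + 2 ≡ ℤ.- mutTerm a b
  cases (inj₁ same) = begin
    (ℤ.- (+ ∣ a ∣ ℤ.* b) ℤ.+ ℤ.- e) / + 2 ≡⟨ cong (λ u → (ℤ.- u ℤ.+ ℤ.- e) / + 2) same ⟩
    (ℤ.- e ℤ.+ ℤ.- e) / + 2               ≡⟨ half-double (ℤ.- e) ⟩
    ℤ.- e                                 ≡⟨ cong ℤ.-_ (sym (half-double e)) ⟩
    ℤ.- ((e ℤ.+ e) / + 2)                 ≡⟨ cong (λ u → ℤ.- ((u ℤ.+ e) / + 2)) (sym same) ⟩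
    ℤ.- mutTerm a b                       ∎
  cases (inj₂ opp) = begin
    (ℤ.- (+ ∣ a ∣ ℤ.* b) ℤ.+ ℤ.- e) / + 2 ≡⟨ cong (λ u → (ℤ.- u ℤ.+ ℤ.- e) / + 2) opp ⟩
    (ℤ.- ℤ.- e ℤ.+ ℤ.- e) / + 2           ≡⟨ cong (_/ + 2) (ℤP.+-inverseˡ (ℤ.- e)) ⟩
    + 0                                   ≡⟨ cong (λ u → ℤ.- (u / + 2)) (sym (ℤP.+-inverseˡ e)) ⟩
    ℤ.- ((ℤ.- e ℤ.+ e) / + 2)             ≡⟨ cong (λ u → ℤ.- ((u ℤ.+ e) / + 2)) (sym opp) ⟩
    ℤ.- mutTerm a b                       ∎

mutMat-involutive : ∀ {n} k (B : Mat n) → mutMat k (mutMat k B) ≐ B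
mutMat-involutive k B = mutMat-cases k (mutMat k B) B
  (λ j → trans (cong ℤ.-_ (mutMat-row k B j)) (ℤP.neg-involutive (B k j)))
  (λ i _ → trans (cong ℤ.-_ (mutMat-col k B i)) (ℤP.neg-involutive (B i k)))
  off
  where
  open ≡-Reasoning
  off : ∀ i j → i ≢ k → j ≢ k → mutMat k B i j ℤ.+ mutTerm (mutMat k B i k) (mutMat k B k j) ≡ B i j
  off i j i≢k j≢k = begin
    mutMat k B i j ℤ.+ mutTerm (mutMat k B i k) (mutMat k B k j)
      ≡⟨ cong₂ ℤ._+_ (mutMat-off k B i≢k j≢k) (cong₂ mutTerm (mutMat-col k B i) (mutMat-row k B j)) ⟩
    (B i j ℤ.+ t) ℤ.+ mutTerm (ℤ.- B i k) (ℤ.- B k j)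
      ≡⟨ cong (ℤ._+_ (B i j ℤ.+ t)) (mutTerm-neg (B i k) (B k j)) ⟩
    (B i j ℤ.+ t) ℤ.+ ℤ.- t
      ≡⟨ ℤP.+-assoc (B i j) t (ℤ.- t) ⟩
    B i j ℤ.+ (t ℤ.+ ℤ.- t)
      ≡⟨ cong (ℤ._+_ (B i j)) (ℤP.+-inverseʳ t) ⟩
    B i j ℤ.+ + 0
      ≡⟨ ℤP.+-identityʳ (B i j) ⟩
    B i j ∎
    where t = mutTerm (B i k) (B k j)

mutMatSeq-reverse : ∀ {n} (ks : List (Fin n)) B → mutMatSeq (reverse ks) (mutMatSeq ks B) ≐ B
mutMatSeq-reverse [] B = λ i j → refl
mutMatSeq-reverse (k ∷ ks) B rewrite List.unfold-reverse k ks | mutMatSeq-++ (reverse ks) (k ∷ []) (mutMatSeq ks (mutMat k B)) =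
  ≐-trans (mutMat-cong k (mutMatSeq-reverse ks (mutMat k B))) (mutMat-involutive k B)

mutMat-sink : ∀ {n} k (B : Mat n) {i j} → i ≢ k → j ≢ k →
  Σ ℕ (λ a → B i k ≡ + a) → Σ ℕ (λ b → B k j ≡ ℤ.- + b) → mutMat k B i j ≡ B i j
mutMat-sink k B {i} {j} i≢k j≢k (a , bik≡a) (b , bkj≡-b) = begin
  mutMat k B i j                          ≡⟨ mutMat-off k B i≢k j≢k ⟩
  B i j ℤ.+ mutTerm (B i k) (B k j)       ≡⟨ cong (ℤ._+_ (B i j)) (cong₂ mutTerm bik≡a bkj≡-b) ⟩
  B i j ℤ.+ mutTerm (+ a) (ℤ.- + b)       ≡⟨ cong (ℤ._+_ (B i j)) (mutTerm-opposite a b) ⟩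
  B i j ℤ.+ + 0                           ≡⟨ ℤP.+-identityʳ (B i j) ⟩
  B i j                                   ∎
  where open ≡-Reasoning


-- Linked mutation sequences

Linked : ∀ {n} → Mat n → Fin n → List (Fin n) → Set
Linked B j [] = ⊤
Linked B j (k ∷ ks) = j ≢ k × 2 ≤ ∣ B j k ∣ × Linked (mutMat k B) k ks

Linked-cong : ∀ {n} {B C : Mat n} j ks → B ≐ C → Linked B j ks → Linked C j ks
Linked-cong j [] _ _ = tt
Linked-cong j (k ∷ ks) B≐C (j≢k , 2≤bjk , linked) =
  j≢k , subst (λ z → 2 ≤ ∣ z ∣) (B≐C j k) 2≤bjk , Linked-cong k ks (mutMat-cong k B≐C) linked

lastOr : ∀ {n} → Fin n → List (Fin n) → Fin n
lastOr j [] = j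
lastOr j (k ∷ ks) = lastOr k ks

Linked-++ : ∀ {n} (B : Mat n) {C} j {l} ks ls → Linked B j ks → mutMatSeq ks B ≐ C → lastOr j ks ≡ l → Linked C l ls →
  Linked B j (ks ++ ls)
Linked-++ B j [] ls _ B≐C refl linked = Linked-cong j ls (≐-sym B≐C) linked
Linked-++ B j (k ∷ ks) ls (j≢k , 2≤bjk , linked) B≐C last linked' =
  j≢k , 2≤bjk , Linked-++ (mutMat k B) k ks ls linked B≐C last linked'

largeWeights⇒linked : ∀ {n} (B : Mat n) j ks i → ConsecDistinct (j ∷ ks ++ i ∷ []) → AlongSeq LargeWeights B ks → Linked B j ks
largeWeights⇒linked B j [] i _ _ = tt
largeWeights⇒linked B j (k ∷ ks) i (j≢k , distinct) (large , along) =
  j≢k , large j k j≢k , largeWeights⇒linked (mutMat k B) k ks i distinct along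

∣mutMat∣-end : ∀ {n} (B : Mat n) k {i j} → k ≡ i ⊎ k ≡ j → ∣ mutMat k B i j ∣ ≡ ∣ B i j ∣
∣mutMat∣-end B k (inj₁ refl) = ∣mutMat-row∣ k B _
∣mutMat∣-end B k (inj₂ refl) = ∣mutMat-col∣ k B _

∣mutMatSeq-rep21∣ : ∀ {m} (a b : Fin (suc (suc m))) r B {i j} → a ≡ i ⊎ a ≡ j → b ≡ i ⊎ b ≡ j →
  ∣ mutMatSeq (rep21 a b r) B i j ∣ ≡ ∣ B i j ∣
∣mutMatSeq-rep21∣ a b zero B _ _ = refl
∣mutMatSeq-rep21∣ a b (suc r) B a∈ b∈ =
  trans (∣mutMatSeq-rep21∣ a b r (mutMat a (mutMat b B)) a∈ b∈) (trans (∣mutMat∣-end (mutMat b B) a a∈) (∣mutMat∣-end B b b∈))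

Linked-rep21 : ∀ {m} (a b : Fin (suc (suc m))) r B → a ≢ b → 2 ≤ ∣ B a b ∣ → 2 ≤ ∣ B b a ∣ → Linked B a (rep21 a b r)
Linked-rep21 a b zero B _ _ _ = tt
Linked-rep21 a b (suc r) B a≢b 2≤ab 2≤ba =
  a≢b , 2≤ab , (λ e → a≢b (sym e)) , subst (2 ≤_) (sym (∣mutMat∣-end B b (inj₁ refl))) 2≤ba ,
  Linked-rep21 a b r (mutMat a (mutMat b B)) a≢b
    (subst (2 ≤_) (sym (∣mutMatSeq-rep21∣ a b 1 B (inj₁ refl) (inj₂ refl))) 2≤ab)
    (subst (2 ≤_) (sym (∣mutMatSeq-rep21∣ a b 1 B (inj₂ refl) (inj₁ refl))) 2≤ba)

lastOr-rep21 : ∀ {m} (a b : Fin (suc (suc m))) r j → lastOr j (rep21 a b (suc r)) ≡ a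
lastOr-rep21 a b zero j = refl
lastOr-rep21 a b (suc r) j = lastOr-rep21 a b r a

reverse-rep21 : ∀ {m} (a b : Fin (suc (suc m))) r → reverse (rep21 a b r) ≡ rep21 b a r
reverse-rep21 a b zero = refl
reverse-rep21 a b (suc r) = begin
  reverse (b ∷ a ∷ rep21 a b r)              ≡⟨ List.reverse-++ (b ∷ a ∷ []) (rep21 a b r) ⟩
  reverse (rep21 a b r) ++ a ∷ b ∷ []        ≡⟨ cong (_++ a ∷ b ∷ []) (reverse-rep21 a b r) ⟩
  rep21 b a r ++ a ∷ b ∷ []                  ≡⟨ rep21-rotate b a r ⟩
  rep21 b a (suc r)                          ∎
  where
  open ≡-Reasoning
  rep21-rotate : ∀ a b r → rep21 a b r ++ b ∷ a ∷ [] ≡ b ∷ a ∷ rep21 a b r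
  rep21-rotate a b zero = refl
  rep21-rotate a b (suc r) = cong (λ l → b ∷ a ∷ l) (rep21-rotate a b r)

map-rep21 : ∀ {m m'} (f : Fin (suc (suc m)) → Fin (suc (suc m'))) a b r → map f (rep21 a b r) ≡ rep21 (f a) (f b) r
map-rep21 f a b zero = refl
map-rep21 f a b (suc r) = cong (λ l → f b ∷ f a ∷ l) (map-rep21 f a b r)


-- Values at (1, …, 1)

-- Nonnegative rationals as unreduced pairs (numerator , denominator).
Ratio : Set
Ratio = ℕ × ℕ

1ʳ : Ratio
1ʳ = 1 , 1

infixl 7 _*ʳ_
infixl 6 _+ʳ_
infix 4 _≤ʳ_ _<ʳ_

_*ʳ_ _+ʳ_ : Ratio → Ratio → Ratio
(a , b) *ʳ (c , d) = a * c , b * d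
(a , b) +ʳ (c , d) = a * d + c * b , b * d

invʳ : Ratio → Ratio
invʳ (a , b) = b , a

_^ʳ_ : Ratio → ℕ → Ratio
x ^ʳ zero = 1ʳ
x ^ʳ suc m = x *ʳ (x ^ʳ m)

prodʳ : ∀ {A : Set} → (A → Ratio) → List A → Ratio
prodʳ f L = foldr _*ʳ_ 1ʳ (map f L)

data _≤ʳ_ : Ratio → Ratio → Set where
  *≤* : ∀ {a b c d} → a * d ≤ c * b → (a , b) ≤ʳ (c , d)

data _<ʳ_ : Ratio → Ratio → Set where
  *<* : ∀ {a b c d} → a * d ℕ.< c * b → (a , b) <ʳ (c , d)

data AtLeastOne : Ratio → Set where
  atLeastOne : ∀ {a b} → 1 ≤ b → b ≤ a → AtLeastOne (a , b)

1ʳ-atLeastOne : AtLeastOne 1ʳ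
1ʳ-atLeastOne = atLeastOne (s≤s z≤n) (s≤s z≤n)

*ʳ-atLeastOne : ∀ {x y} → AtLeastOne x → AtLeastOne y → AtLeastOne (x *ʳ y)
*ʳ-atLeastOne (atLeastOne 1≤b b≤a) (atLeastOne 1≤d d≤c) = atLeastOne (ℕP.*-mono-≤ 1≤b 1≤d) (ℕP.*-mono-≤ b≤a d≤c)

^ʳ-atLeastOne : ∀ {x} m → AtLeastOne x → AtLeastOne (x ^ʳ m)
^ʳ-atLeastOne zero _ = 1ʳ-atLeastOne
^ʳ-atLeastOne (suc m) x≥1 = *ʳ-atLeastOne x≥1 (^ʳ-atLeastOne m x≥1)

prodʳ-atLeastOne : ∀ {A : Set} {f : A → Ratio} L → (∀ i → AtLeastOne (f i)) → AtLeastOne (prodʳ f L)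
prodʳ-atLeastOne [] _ = 1ʳ-atLeastOne
prodʳ-atLeastOne (i ∷ L) f≥1 = *ʳ-atLeastOne (f≥1 i) (prodʳ-atLeastOne L f≥1)

1ʳ≤ʳ : ∀ {x} → AtLeastOne x → 1ʳ ≤ʳ x
1ʳ≤ʳ {a , b} (atLeastOne _ b≤a) = *≤* (begin
  1 * b ≡⟨ ℕP.*-identityˡ b ⟩
  b     ≤⟨ b≤a ⟩
  a     ≡⟨ sym (ℕP.*-identityʳ a) ⟩
  a * 1 ∎)
  where open ℕP.≤-Reasoning

atLeastOne-from-1<ʳ : ∀ {a b} → 1 ≤ b → 1ʳ <ʳ (a , b) → AtLeastOne (a , b)
atLeastOne-from-1<ʳ {a} {b} 1≤b (*<* 1<x) = atLeastOne 1≤b (ℕP.<⇒≤ (begin-strict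
  b     ≡⟨ sym (ℕP.*-identityˡ b) ⟩
  1 * b <⟨ 1<x ⟩
  a * 1 ≡⟨ ℕP.*-identityʳ a ⟩
  a     ∎))
  where open ℕP.≤-Reasoning

*ʳ-growʳ : ∀ {t x y} → AtLeastOne y → t ≤ʳ x → t ≤ʳ x *ʳ y
*ʳ-growʳ {p , q} {a , b} {c , d} (atLeastOne _ d≤c) (*≤* t≤x) = *≤* (begin
  p * (b * d) ≡⟨ solve (p ∷ b ∷ d ∷ []) ⟩
  p * b * d   ≤⟨ ℕP.*-mono-≤ t≤x d≤c ⟩
  a * q * c   ≡⟨ solve (a ∷ q ∷ c ∷ []) ⟩
  a * c * q   ∎)
  where open ℕP.≤-Reasoning

*ʳ-growˡ : ∀ {t x y} → AtLeastOne x → t ≤ʳ y → t ≤ʳ x *ʳ y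
*ʳ-growˡ {p , q} {a , b} {c , d} (atLeastOne _ b≤a) (*≤* t≤y) = *≤* (begin
  p * (b * d) ≡⟨ solve (p ∷ b ∷ d ∷ []) ⟩
  b * (p * d) ≤⟨ ℕP.*-mono-≤ b≤a t≤y ⟩
  a * (c * q) ≡⟨ solve (a ∷ c ∷ q ∷ []) ⟩
  a * c * q   ∎)
  where open ℕP.≤-Reasoning

square≤ʳ^ʳ : ∀ {x} e → AtLeastOne x → 2 ≤ e → x *ʳ x ≤ʳ x ^ʳ e
square≤ʳ^ʳ (suc zero) _ (s≤s ())
square≤ʳ^ʳ {a , b} (suc (suc e)) x≥1 _ with (a , b) ^ʳ e | ^ʳ-atLeastOne e x≥1
... | c , d | atLeastOne _ d≤c = *≤* (begin
  a * a * (b * (b * d)) ≡⟨ solve (a ∷ b ∷ d ∷ []) ⟩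
  a * a * (b * b) * d   ≤⟨ ℕP.*-monoʳ-≤ (a * a * (b * b)) d≤c ⟩
  a * a * (b * b) * c   ≡⟨ solve (a ∷ b ∷ c ∷ []) ⟩
  a * (a * c) * (b * b) ∎)
  where open ℕP.≤-Reasoning

≤ʳ-prodʳ : ∀ {A : Set} {f : A → Ratio} {t j} L → (∀ i → AtLeastOne (f i)) → j ∈ L → t ≤ʳ f j → t ≤ʳ prodʳ f L
≤ʳ-prodʳ (i ∷ L) f≥1 (here refl) t≤fj = *ʳ-growʳ (prodʳ-atLeastOne L f≥1) t≤fj
≤ʳ-prodʳ (i ∷ L) f≥1 (there j∈L) t≤fj = *ʳ-growˡ (f≥1 i) (≤ʳ-prodʳ L f≥1 j∈L t≤fj)

<ʳ-+ʳ : ∀ {p q x y} → AtLeastOne x → AtLeastOne y → 1 ≤ q → (p , q) ≤ʳ x ⊎ (p , q) ≤ʳ y → (p , q) <ʳ x +ʳ y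
<ʳ-+ʳ {p} {q} {a , b} {c , d} (atLeastOne 1≤b b≤a) (atLeastOne 1≤d d≤c) 1≤q (inj₁ (*≤* t≤x)) = *<* (begin-strict
  p * (b * d)           ≡⟨ solve (p ∷ b ∷ d ∷ []) ⟩
  p * b * d             ≤⟨ ℕP.*-monoˡ-≤ d t≤x ⟩
  a * q * d             ≡⟨ solve (a ∷ q ∷ d ∷ []) ⟩
  a * d * q + 0         <⟨ ℕP.+-monoʳ-< (a * d * q) (ℕP.*-mono-≤ (ℕP.*-mono-≤ (ℕP.≤-trans 1≤d d≤c) 1≤b) 1≤q) ⟩
  a * d * q + c * b * q ≡⟨ solve (a ∷ b ∷ c ∷ d ∷ q ∷ []) ⟩
  (a * d + c * b) * q   ∎)
  where open ℕP.≤-Reasoning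
<ʳ-+ʳ {p} {q} {a , b} {c , d} (atLeastOne 1≤b b≤a) (atLeastOne 1≤d d≤c) 1≤q (inj₂ (*≤* t≤y)) = *<* (begin-strict
  p * (b * d)           ≡⟨ solve (p ∷ b ∷ d ∷ []) ⟩
  b * (p * d)           ≤⟨ ℕP.*-monoʳ-≤ b t≤y ⟩
  b * (c * q)           ≡⟨ solve (b ∷ c ∷ q ∷ []) ⟩
  0 + c * b * q         <⟨ ℕP.+-monoˡ-< (c * b * q) (ℕP.*-mono-≤ (ℕP.*-mono-≤ (ℕP.≤-trans 1≤b b≤a) 1≤d) 1≤q) ⟩
  a * d * q + c * b * q ≡⟨ solve (a ∷ b ∷ c ∷ d ∷ q ∷ []) ⟩
  (a * d + c * b) * q   ∎)
  where open ℕP.≤-Reasoning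

<ʳ⇒≤ʳ : ∀ {x y} → x <ʳ y → x ≤ʳ y
<ʳ⇒≤ʳ (*<* x<y) = *≤* (ℕP.<⇒≤ x<y)

≤ʳ-refl : ∀ {x} → x ≤ʳ x
≤ʳ-refl = *≤* ℕP.≤-refl

≤ʳ-<ʳ-trans : ∀ {a b y z} → 1 ≤ b → (a , b) ≤ʳ y → y <ʳ z → (a , b) <ʳ z
≤ʳ-<ʳ-trans {a} {b} {c , d} {e , f} 1≤b (*≤* x≤y) (*<* y<z) = *<* (ℕP.*-cancelʳ-< d _ _ (begin-strict
  a * f * d ≡⟨ solve (a ∷ d ∷ f ∷ []) ⟩
  a * d * f ≤⟨ ℕP.*-monoˡ-≤ f x≤y ⟩
  c * b * f ≡⟨ solve (b ∷ c ∷ f ∷ []) ⟩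
  c * f * b <⟨ ℕP.*-monoˡ-< b {{ℕ.>-nonZero 1≤b}} y<z ⟩
  e * d * b ≡⟨ solve (b ∷ d ∷ e ∷ []) ⟩
  e * b * d ∎))
  where open ℕP.≤-Reasoning

<ʳ-*ʳ-invʳ : ∀ {x s c d} → 1 ≤ d → x *ʳ x <ʳ s → (c , d) ≤ʳ x → x <ʳ s *ʳ invʳ (c , d)
<ʳ-*ʳ-invʳ {a , b} {S , T} {c} {d} 1≤d (*<* x²<s) (*≤* y≤x) = *<* (ℕP.*-cancelʳ-< b _ _ (begin-strict
  a * (T * c) * b   ≡⟨ solve (a ∷ b ∷ c ∷ T ∷ []) ⟩
  a * T * (c * b)   ≤⟨ ℕP.*-monoʳ-≤ (a * T) y≤x ⟩
  a * T * (a * d)   ≡⟨ solve (a ∷ d ∷ T ∷ []) ⟩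
  a * a * T * d     <⟨ ℕP.*-monoˡ-< d {{ℕ.>-nonZero 1≤d}} x²<s ⟩
  S * (b * b) * d   ≡⟨ solve (b ∷ d ∷ S ∷ []) ⟩
  S * d * b * b     ∎))
  where open ℕP.≤-Reasoning

pos≥2-or-neg≥2 : ∀ z → 2 ≤ ∣ z ∣ → 2 ≤ pos z ⊎ 2 ≤ pos (ℤ.- z)
pos≥2-or-neg≥2 (+ m) h = inj₁ h
pos≥2-or-neg≥2 -[1+ m ] h = inj₂ h

den≥1 : ∀ {a b} → AtLeastOne (a , b) → 1 ≤ b
den≥1 (atLeastOne 1≤b _) = 1≤b


module _ {n : ℕ} where

  -- Numerator of the exchange relation, with every coefficient specialised to 1.
  exchangeNumʳ : Fin n → (Fin n → Ratio) → Mat n → Ratio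
  exchangeNumʳ k c B = prodʳ (λ i → c i ^ʳ pos (B i k)) (allFin n) +ʳ prodʳ (λ i → c i ^ʳ pos (ℤ.- B i k)) (allFin n)

  mutClʳ : Fin n → (Fin n → Ratio) → Mat n → Fin n → Ratio
  mutClʳ k c B j with j ≟ k
  ... | yes _ = exchangeNumʳ k c B *ʳ invʳ (c k)
  ... | no _ = c j

  mutClSeqʳ : List (Fin n) → (Fin n → Ratio) → Mat n → Fin n → Ratio
  mutClSeqʳ [] c B = c
  mutClSeqʳ (k ∷ ks) c B = mutClSeqʳ ks (mutClʳ k c B) (mutMat k B)

  mutClʳ-at : ∀ k c B → mutClʳ k c B k ≡ exchangeNumʳ k c B *ʳ invʳ (c k)
  mutClʳ-at k c B with k ≟ k
  ... | yes _ = refl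
  ... | no k≢k = contradiction refl k≢k

  mutClʳ-away : ∀ k c B {i} → i ≢ k → mutClʳ k c B i ≡ c i
  mutClʳ-away k c B {i} i≢k with i ≟ k
  ... | yes i≡k = contradiction i≡k i≢k
  ... | no _ = refl

  record Dominant (j : Fin n) (c : Fin n → Ratio) : Set where
    field
      allAtLeastOne : ∀ i → AtLeastOne (c i)
      aboveOne : 1ʳ <ʳ c j
      aboveRest : ∀ i → i ≢ j → c i <ʳ c j

  monomial-atLeastOne : ∀ {c : Fin n → Ratio} (e : Fin n → ℕ) → (∀ i → AtLeastOne (c i)) →
    AtLeastOne (prodʳ (λ i → c i ^ʳ e i) (allFin n))
  monomial-atLeastOne {c} e c≥1 = prodʳ-atLeastOne {f = λ i → c i ^ʳ e i} (allFin n) (λ i → ^ʳ-atLeastOne (e i) (c≥1 i))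

  -- A double arrow between j and k makes c j ^ 2 divide one of the two monomials.
  square<ʳexchangeNumʳ : ∀ {j k c} B → (∀ i → AtLeastOne (c i)) → 2 ≤ ∣ B j k ∣ → c j *ʳ c j <ʳ exchangeNumʳ k c B
  square<ʳexchangeNumʳ {j} {k} {c} B c≥1 2≤bjk =
    <ʳ-+ʳ (monomial-atLeastOne _ c≥1) (monomial-atLeastOne _ c≥1) (den≥1 (*ʳ-atLeastOne (c≥1 j) (c≥1 j))) square≤
    where
    square≤ : c j *ʳ c j ≤ʳ prodʳ (λ i → c i ^ʳ pos (B i k)) (allFin n)
            ⊎ c j *ʳ c j ≤ʳ prodʳ (λ i → c i ^ʳ pos (ℤ.- B i k)) (allFin n)
    square≤ with pos≥2-or-neg≥2 (B j k) 2≤bjk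
    ... | inj₁ h = inj₁ (≤ʳ-prodʳ (allFin n) (λ i → ^ʳ-atLeastOne _ (c≥1 i)) (∈-allFin j) (square≤ʳ^ʳ _ (c≥1 j) h))
    ... | inj₂ h = inj₂ (≤ʳ-prodʳ (allFin n) (λ i → ^ʳ-atLeastOne _ (c≥1 i)) (∈-allFin j) (square≤ʳ^ʳ _ (c≥1 j) h))

  mutClʳ-dominant : ∀ {k c B x} → (∀ i → AtLeastOne (c i)) → 1ʳ ≤ʳ x → (∀ i → c i ≤ʳ x) →
    x *ʳ x <ʳ exchangeNumʳ k c B → Dominant k (mutClʳ k c B)
  mutClʳ-dominant {k} {c} {B} {x} c≥1 1≤x c≤x x²<N = record
    { allAtLeastOne = allAtLeastOne
    ; aboveOne = subst (1ʳ <ʳ_) (sym (mutClʳ-at k c B)) 1<new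
    ; aboveRest = aboveRest }
    where
    new = exchangeNumʳ k c B *ʳ invʳ (c k)
    x<new : x <ʳ new
    x<new = <ʳ-*ʳ-invʳ (den≥1 (c≥1 k)) x²<N (c≤x k)
    1<new : 1ʳ <ʳ new
    1<new = ≤ʳ-<ʳ-trans (s≤s z≤n) 1≤x x<new
    new≥1 : AtLeastOne new
    new≥1 with monomial-atLeastOne (λ i → pos (B i k)) c≥1 | monomial-atLeastOne (λ i → pos (ℤ.- B i k)) c≥1 | c≥1 k
    ... | atLeastOne 1≤b _ | atLeastOne 1≤d _ | atLeastOne 1≤f f≤e =
      atLeastOne-from-1<ʳ (ℕP.*-mono-≤ (ℕP.*-mono-≤ 1≤b 1≤d) (ℕP.≤-trans 1≤f f≤e)) 1<new
    allAtLeastOne : ∀ i → AtLeastOne (mutClʳ k c B i)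
    allAtLeastOne i with i ≟ k
    ... | yes _ = new≥1
    ... | no _ = c≥1 i
    aboveRest : ∀ i → i ≢ k → mutClʳ k c B i <ʳ mutClʳ k c B k
    aboveRest i i≢k rewrite mutClʳ-at k c B | mutClʳ-away k c B i≢k = ≤ʳ-<ʳ-trans (den≥1 (c≥1 i)) (c≤x i) x<new

  mutClʳ-ones : ∀ k B → Dominant k (mutClʳ k (λ _ → 1ʳ) B)
  mutClʳ-ones k B = mutClʳ-dominant (λ _ → 1ʳ-atLeastOne) ≤ʳ-refl (λ _ → ≤ʳ-refl)
    (<ʳ-+ʳ (monomial-atLeastOne _ ones≥1) (monomial-atLeastOne _ ones≥1) (s≤s z≤n) (inj₁ (1ʳ≤ʳ (monomial-atLeastOne _ ones≥1))))
    where
    ones≥1 : ∀ (i : Fin n) → AtLeastOne 1ʳ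
    ones≥1 _ = 1ʳ-atLeastOne

  mutClʳ-linked : ∀ {j k c} B → Dominant j c → j ≢ k → 2 ≤ ∣ B j k ∣ → Dominant k (mutClʳ k c B)
  mutClʳ-linked {j} {k} {c} B dom j≢k 2≤bjk =
    mutClʳ-dominant allAtLeastOne (1ʳ≤ʳ (allAtLeastOne j)) c≤cj (square<ʳexchangeNumʳ B allAtLeastOne 2≤bjk)
    where
    open Dominant dom
    c≤cj : ∀ i → c i ≤ʳ c j
    c≤cj i with i ≟ j
    ... | yes refl = ≤ʳ-refl
    ... | no i≢j = <ʳ⇒≤ʳ (aboveRest i i≢j)

  mutClSeqʳ-aboveOne : ∀ {j c} B ks → Dominant j c → Linked B j ks → ∃ λ i → 1ʳ <ʳ mutClSeqʳ ks c B i
  mutClSeqʳ-aboveOne {j} B [] dom _ = j , Dominant.aboveOne dom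
  mutClSeqʳ-aboveOne B (k ∷ ks) dom (j≢k , 2≤bjk , linked) =
    mutClSeqʳ-aboveOne (mutMat k B) ks (mutClʳ-linked B dom j≢k 2≤bjk) linked

  mutClSeqʳ-ones-aboveOne : ∀ B k ks → Linked (mutMat k B) k ks → ∃ λ i → 1ʳ <ʳ mutClSeqʳ (k ∷ ks) (λ _ → 1ʳ) B i
  mutClSeqʳ-ones-aboveOne B k ks = mutClSeqʳ-aboveOne (mutMat k B) ks (mutClʳ-ones k B)


-- Evaluation of cluster variables

module _ {c ℓ} (P : Semifield c ℓ) (n : ℕ) where
  open Field P n
  open Semifield P using (Carrier; _⊕_; 1#; _⁻¹)

  exprRing : CommutativeRing c (c ⊔ ℓ)
  exprRing = record
    { Carrier = Expr ; _≈_ = _≈E_ ; _+_ = _+E_ ; _*_ = _*E_ ; -_ = -E_ ; 0# = 0E ; 1# = 1E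
    ; isCommutativeRing = record
      { isRing = record
        { +-isAbelianGroup = record
          { isGroup = record
            { isMonoid = record
              { isSemigroup = record
                { isMagma = record
                  { isEquivalence = record { refl = ≈refl ; sym = ≈sym ; trans = ≈trans }
                  ; ∙-cong = +cong }
                ; assoc = +assoc }
              ; identity = (λ a → ≈trans (+comm 0E a) (+idʳ a)) , +idʳ }
            ; inverse = (λ a → ≈trans (+comm (-E a) a) (-invʳ a)) , -invʳ
            ; ⁻¹-cong = -cong }
          ; comm = +comm }
        ; *-cong = *cong
        ; *-assoc = *assoc
        ; *-identity = (λ a → ≈trans (*comm 1E a) (*idʳ a)) , *idʳ
        ; distrib = (λ a b d → ≈trans (*comm a (b +E d)) (≈trans (distribʳ b d a) (+cong (*comm b a) (*comm d a))))
                  , (λ a b d → distribʳ b d a) }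
      ; *-comm = *comm } }

  atOne : Expr → ℤ
  atOne (con _) = + 1
  atOne (var _) = + 1
  atOne 0E = + 0
  atOne 1E = + 1
  atOne (a +E b) = atOne a ℤ.+ atOne b
  atOne (a *E b) = atOne a ℤ.* atOne b
  atOne (-E a) = ℤ.- atOne a

  atOne-cong : ∀ {a b} → a ≈E b → atOne a ≡ atOne b
  atOne-cong ≈refl = refl
  atOne-cong (≈sym h) = sym (atOne-cong h)
  atOne-cong (≈trans h h') = trans (atOne-cong h) (atOne-cong h')
  atOne-cong (+cong h h') = cong₂ ℤ._+_ (atOne-cong h) (atOne-cong h')
  atOne-cong (*cong h h') = cong₂ ℤ._*_ (atOne-cong h) (atOne-cong h')
  atOne-cong (-cong h) = cong ℤ.-_ (atOne-cong h)
  atOne-cong (+assoc a b d) = ℤP.+-assoc (atOne a) (atOne b) (atOne d)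
  atOne-cong (+comm a b) = ℤP.+-comm (atOne a) (atOne b)
  atOne-cong (+idʳ a) = ℤP.+-identityʳ (atOne a)
  atOne-cong (-invʳ a) = ℤP.+-inverseʳ (atOne a)
  atOne-cong (*assoc a b d) = ℤP.*-assoc (atOne a) (atOne b) (atOne d)
  atOne-cong (*comm a b) = ℤP.*-comm (atOne a) (atOne b)
  atOne-cong (*idʳ a) = ℤP.*-identityʳ (atOne a)
  atOne-cong (distribʳ a b d) = ℤP.*-distribʳ-+ (atOne d) (atOne a) (atOne b)
  atOne-cong (con-cong _) = refl
  atOne-cong (con-mul p q) = refl
  atOne-cong con-one = refl

  data ValueAtOne : F → Ratio → Set c where
    valueAtOne : ∀ {u v a b} → atOne u ≡ + a → atOne v ≡ + b → ValueAtOne (u , v) (a , b)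

  valueAtOne-* : ∀ {f g r s} → ValueAtOne f r → ValueAtOne g s → ValueAtOne (f *F g) (r *ʳ s)
  valueAtOne-* (valueAtOne {a = a} {b} u≡a v≡b) (valueAtOne {a = c} {d} u'≡c v'≡d) =
    valueAtOne (trans (cong₂ ℤ._*_ u≡a u'≡c) (sym (ℤP.pos-* a c))) (trans (cong₂ ℤ._*_ v≡b v'≡d) (sym (ℤP.pos-* b d)))

  valueAtOne-+ : ∀ {f g r s} → ValueAtOne f r → ValueAtOne g s → ValueAtOne (f +F g) (r +ʳ s)
  valueAtOne-+ (valueAtOne {a = a} {b} u≡a v≡b) (valueAtOne {a = c} {d} u'≡c v'≡d) = valueAtOne
    (trans (cong₂ ℤ._+_ (cong₂ ℤ._*_ u≡a v'≡d) (cong₂ ℤ._*_ u'≡c v≡b))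
      (trans (cong₂ ℤ._+_ (sym (ℤP.pos-* a d)) (sym (ℤP.pos-* c b))) (sym (ℤP.pos-+ (a ℕ.* d) (c ℕ.* b)))))
    (trans (cong₂ ℤ._*_ v≡b v'≡d) (sym (ℤP.pos-* b d)))

  valueAtOne-inv : ∀ {f r} → ValueAtOne f r → ValueAtOne (invF f) (invʳ r)
  valueAtOne-inv (valueAtOne u≡a v≡b) = valueAtOne v≡b u≡a

  valueAtOne-con* : ∀ p {f r} → ValueAtOne f r → ValueAtOne (conF p *F f) r
  valueAtOne-con* p (valueAtOne u≡a v≡b) = valueAtOne (trans (ℤP.*-identityˡ _) u≡a) (trans (ℤP.*-identityˡ _) v≡b)

  valueAtOne-1 : ValueAtOne 1F 1ʳ
  valueAtOne-1 = valueAtOne refl refl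

  valueAtOne-^ : ∀ {f r} m → ValueAtOne f r → ValueAtOne (f ^F m) (r ^ʳ m)
  valueAtOne-^ zero _ = valueAtOne-1
  valueAtOne-^ (suc m) h = valueAtOne-* h (valueAtOne-^ m h)

  valueAtOne-prod : ∀ {f : Fin n → F} {r : Fin n → Ratio} L → (∀ i → ValueAtOne (f i) (r i)) →
    ValueAtOne (foldr _*F_ 1F (map f L)) (prodʳ r L)
  valueAtOne-prod [] _ = valueAtOne-1
  valueAtOne-prod (i ∷ L) h = valueAtOne-* (h i) (valueAtOne-prod L h)

  mutSeed-valueAtOne : ∀ k x y M (r : Fin n → Ratio) → (∀ i → ValueAtOne (x i) (r i)) →
    ∀ i → ValueAtOne (Seed.cl (mutSeed k (seed x y M)) i) (mutClʳ k r M i)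
  mutSeed-valueAtOne k x y M r x∼r i with i ≟ k
  ... | yes _ = valueAtOne-* (valueAtOne-+ (valueAtOne-con* (y k) (valueAtOne-prod (allFin n) (λ j → valueAtOne-^ (pos (M j k)) (x∼r j))))
                                   (valueAtOne-prod (allFin n) (λ j → valueAtOne-^ (pos (ℤ.- M j k)) (x∼r j))))
                         (valueAtOne-inv (valueAtOne-con* (y k ⊕ 1#) (x∼r k)))
  ... | no _ = x∼r i

  mutSeedSeq-valueAtOne : ∀ ks x y M (r : Fin n → Ratio) → (∀ i → ValueAtOne (x i) (r i)) →
    ∀ i → ValueAtOne (Seed.cl (mutSeedSeq ks (seed x y M)) i) (mutClSeqʳ ks r M i)
  mutSeedSeq-valueAtOne [] x y M r x∼r = x∼r
  mutSeedSeq-valueAtOne (k ∷ ks) x y M r x∼r =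
    mutSeedSeq-valueAtOne ks (Seed.cl (mutSeed k (seed x y M))) (Seed.co (mutSeed k (seed x y M))) (mutMat k M)
      (mutClʳ k r M) (mutSeed-valueAtOne k x y M r x∼r)

  mutSeed-co : ∀ k {xs xa : Fin n → F} {ys ya : Fin n → Carrier} M → (∀ i → ys i ≡ ya i) →
    ∀ i → Seed.co (mutSeed k (seed xs ys M)) i ≡ Seed.co (mutSeed k (seed xa ya M)) i
  mutSeed-co k M ys≡ya i with i ≟ k
  ... | yes _ = cong _⁻¹ (ys≡ya k)
  ... | no _ rewrite ys≡ya i | ys≡ya k = refl

  module Evaluation (x : Fin n → F) where
    open import Algebra.Solver.Ring.NaturalCoefficients.Default (CommutativeRing.commutativeSemiring exprRing)
      using (_:=_; _:+_; _:*_) renaming (solve to solveE)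
    open import Relation.Binary.Reasoning.Setoid (CommutativeRing.setoid exprRing)

    evalFrac : F → F
    evalFrac (U , V) = eval x U *F invF (eval x V)

    -- s ⇝ f: the fraction s of polynomials takes the value f at x, as a proportionality of
    -- numerators and denominators with explicit factor l.  Equality in F is cross-multiplication,
    -- which cannot be cancelled here, so the factor is what makes the relation compose.
    infix 4 _⇝_
    data _⇝_ : F → F → Set (c ⊔ ℓ) where
      prop : ∀ {s u v} l → proj₁ (evalFrac s) ≈E l *E u → proj₂ (evalFrac s) ≈E l *E v → s ⇝ (u , v)

    ⇝-* : ∀ {s s' f f'} → s ⇝ f → s' ⇝ f' → s *F s' ⇝ f *F f'
    ⇝-* {U , V} {U' , V'} (prop {u = u} {v} l e₁ e₂) (prop {u = u'} {v'} l' f₁ f₂) = prop (l *E l') num den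
      where
      pU = proj₁ (eval x U); qU = proj₂ (eval x U); pV = proj₁ (eval x V); qV = proj₂ (eval x V)
      pU' = proj₁ (eval x U'); qU' = proj₂ (eval x U'); pV' = proj₁ (eval x V'); qV' = proj₂ (eval x V')
      swap = solveE 4 (λ a b d e → ((a :* b) :* (d :* e)) := ((a :* d) :* (b :* e))) ≈refl
      num : (pU *E pU') *E (qV *E qV') ≈E (l *E l') *E (u *E u')
      num = begin
        (pU *E pU') *E (qV *E qV') ≈⟨ swap pU pU' qV qV' ⟩
        (pU *E qV) *E (pU' *E qV') ≈⟨ *cong e₁ f₁ ⟩
        (l *E u) *E (l' *E u')     ≈⟨ swap l u l' u' ⟩
        (l *E l') *E (u *E u')     ∎
      den : (qU *E qU') *E (pV *E pV') ≈E (l *E l') *E (v *E v')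
      den = begin
        (qU *E qU') *E (pV *E pV') ≈⟨ swap qU qU' pV pV' ⟩
        (qU *E pV) *E (qU' *E pV') ≈⟨ *cong e₂ f₂ ⟩
        (l *E v) *E (l' *E v')     ≈⟨ swap l v l' v' ⟩
        (l *E l') *E (v *E v')     ∎

    ⇝-+ : ∀ {s s' f f'} → s ⇝ f → s' ⇝ f' → s +F s' ⇝ f +F f'
    ⇝-+ {U , V} {U' , V'} (prop {u = u} {v} l e₁ e₂) (prop {u = u'} {v'} l' f₁ f₂) = prop ((qV *E qV') *E (l *E l')) num den
      where
      pU = proj₁ (eval x U); qU = proj₂ (eval x U); pV = proj₁ (eval x V); qV = proj₂ (eval x V)
      pU' = proj₁ (eval x U'); qU' = proj₂ (eval x U'); pV' = proj₁ (eval x V'); qV' = proj₂ (eval x V')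
      num : ((pU *E pV') *E (qU' *E qV) +E (pU' *E pV) *E (qU *E qV')) *E (qV *E qV')
            ≈E ((qV *E qV') *E (l *E l')) *E (u *E v' +E u' *E v)
      num = begin
        ((pU *E pV') *E (qU' *E qV) +E (pU' *E pV) *E (qU *E qV')) *E (qV *E qV')
          ≈⟨ solveE 8 (λ a b d e f g h i → ((((a :* b) :* (d :* e)) :+ ((f :* g) :* (h :* i))) :* (e :* i))
                 := ((e :* i) :* (((a :* e) :* (d :* b)) :+ ((f :* i) :* (h :* g))))) ≈refl pU pV' qU' qV pU' pV qU qV' ⟩
        (qV *E qV') *E ((pU *E qV) *E (qU' *E pV') +E (pU' *E qV') *E (qU *E pV))
          ≈⟨ *cong ≈refl (+cong (*cong e₁ f₂) (*cong f₁ e₂)) ⟩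
        (qV *E qV') *E ((l *E u) *E (l' *E v') +E (l' *E u') *E (l *E v))
          ≈⟨ solveE 7 (λ w a b d e f g → (w :* (((a :* b) :* (d :* e)) :+ ((d :* f) :* (a :* g))))
                 := ((w :* (a :* d)) :* ((b :* e) :+ (f :* g)))) ≈refl (qV *E qV') l u l' v' u' v ⟩
        ((qV *E qV') *E (l *E l')) *E (u *E v' +E u' *E v) ∎
      den : ((qU *E qV') *E (qU' *E qV)) *E (pV *E pV') ≈E ((qV *E qV') *E (l *E l')) *E (v *E v')
      den = begin
        ((qU *E qV') *E (qU' *E qV)) *E (pV *E pV')
          ≈⟨ solveE 6 (λ a b d e f g → (((a :* b) :* (d :* e)) :* (f :* g)) := ((e :* b) :* ((a :* f) :* (d :* g))))
                 ≈refl qU qV' qU' qV pV pV' ⟩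
        (qV *E qV') *E ((qU *E pV) *E (qU' *E pV'))
          ≈⟨ *cong ≈refl (*cong e₂ f₂) ⟩
        (qV *E qV') *E ((l *E v) *E (l' *E v'))
          ≈⟨ solveE 5 (λ w a b d e → (w :* ((a :* b) :* (d :* e))) := ((w :* (a :* d)) :* (b :* e))) ≈refl (qV *E qV') l v l' v' ⟩
        ((qV *E qV') *E (l *E l')) *E (v *E v') ∎

    ⇝-inv : ∀ {s f} → s ⇝ f → invF s ⇝ invF f
    ⇝-inv (prop l e₁ e₂) = prop l (≈trans (*comm _ _) e₂) (≈trans (*comm _ _) e₁)

    ⇝-con : ∀ p → conF p ⇝ conF p
    ⇝-con p = prop 1E (*comm (con p) 1E) ≈refl

    ⇝-1 : 1F ⇝ 1F
    ⇝-1 = prop 1E ≈refl ≈refl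

    ⇝-^ : ∀ {s f} m → s ⇝ f → s ^F m ⇝ f ^F m
    ⇝-^ zero _ = ⇝-1
    ⇝-^ (suc m) h = ⇝-* h (⇝-^ m h)

    ⇝-prod : ∀ {s f : Fin n → F} L → (∀ i → s i ⇝ f i) → foldr _*F_ 1F (map s L) ⇝ foldr _*F_ 1F (map f L)
    ⇝-prod [] _ = ⇝-1
    ⇝-prod (i ∷ L) h = ⇝-* (h i) (⇝-prod L h)

    mutSeed-⇝ : ∀ k {xs xa : Fin n → F} {ys ya : Fin n → Carrier} M → (∀ i → xs i ⇝ xa i) → (∀ i → ys i ≡ ya i) →
      ∀ i → Seed.cl (mutSeed k (seed xs ys M)) i ⇝ Seed.cl (mutSeed k (seed xa ya M)) i
    mutSeed-⇝ k M xs⇝xa ys≡ya i with i ≟ k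
    ... | yes _ = ⇝-* (⇝-+ (⇝-* (con⇝ (ys≡ya k)) (⇝-prod (allFin n) (λ j → ⇝-^ (pos (M j k)) (xs⇝xa j))))
                            (⇝-prod (allFin n) (λ j → ⇝-^ (pos (ℤ.- M j k)) (xs⇝xa j))))
                      (⇝-inv (⇝-* (con⇝ (cong (_⊕ 1#) (ys≡ya k))) (xs⇝xa k)))
      where
      con⇝ : ∀ {p q} → p ≡ q → conF p ⇝ conF q
      con⇝ {p} refl = ⇝-con p
    ... | no _ = xs⇝xa i

    mutSeedSeq-⇝ : ∀ ks {xs xa : Fin n → F} {ys ya : Fin n → Carrier} M → (∀ i → xs i ⇝ xa i) → (∀ i → ys i ≡ ya i) →
      ∀ i → Seed.cl (mutSeedSeq ks (seed xs ys M)) i ⇝ Seed.cl (mutSeedSeq ks (seed xa ya M)) i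
    mutSeedSeq-⇝ [] M xs⇝xa _ = xs⇝xa
    mutSeedSeq-⇝ (k ∷ ks) {xs} {xa} M xs⇝xa ys≡ya =
      mutSeedSeq-⇝ ks (mutMat k M) (mutSeed-⇝ k M xs⇝xa ys≡ya) (mutSeed-co k {xs} {xa} M ys≡ya)

    ⇝xᵢ⇒root : ∀ {U V f i} → (U , V) ⇝ f → f ≈F x i → eval x (U +E -E (var i *E V)) ≈F 0F
    ⇝xᵢ⇒root {U} {V} {u , v} {i} (prop l e₁ e₂) f≈xi = begin
        (pU *E (bi *E qV) +E (-E (ai *E pV)) *E qU) *E 1E
          ≈⟨ *idʳ _ ⟩
        pU *E (bi *E qV) +E (-E (ai *E pV)) *E qU
          ≈⟨ +cong ≈refl (≈sym (-‿distribˡ-* (ai *E pV) qU)) ⟩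
        pU *E (bi *E qV) +E -E ((ai *E pV) *E qU)
          ≈⟨ +cong (solveE 3 (λ a b d → (a :* (b :* d)) := (b :* (a :* d))) ≈refl pU bi qV)
                   (-cong (solveE 3 (λ a b d → ((a :* b) :* d) := (a :* (d :* b))) ≈refl ai pV qU)) ⟩
        bi *E (pU *E qV) +E -E (ai *E (qU *E pV))
          ≈⟨ +cong (*cong ≈refl e₁) (-cong (*cong ≈refl e₂)) ⟩
        bi *E (l *E u) +E -E (ai *E (l *E v))
          ≈⟨ +cong (solveE 3 (λ a b d → (a :* (b :* d)) := (b :* (d :* a))) ≈refl bi l u)
                   (-cong (solveE 3 (λ a b d → (a :* (b :* d)) := (b :* (a :* d))) ≈refl ai l v)) ⟩
        l *E (u *E bi) +E -E (l *E (ai *E v))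
          ≈⟨ +cong (*cong ≈refl f≈xi) ≈refl ⟩
        l *E (ai *E v) +E -E (l *E (ai *E v))
          ≈⟨ -invʳ _ ⟩
        0E
          ≈⟨ ≈sym (CommutativeRing.zeroˡ exprRing _) ⟩
        0E *E _ ∎
      where
      open import Algebra.Properties.Ring (CommutativeRing.ring exprRing) using (-‿distribˡ-*)
      pU = proj₁ (eval x U); qU = proj₂ (eval x U); pV = proj₁ (eval x V); qV = proj₂ (eval x V)
      ai = proj₁ (x i); bi = proj₂ (x i)

  aboveOne⇒≉var : ∀ {U V r} i → ValueAtOne (U , V) r → 1ʳ <ʳ r → ¬ (U +E -E (var i *E V) ≈E 0E)
  aboveOne⇒≉var {U} {V} i (valueAtOne {a = p} {q} U≡p V≡q) (*<* q<p) U≈tV =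
    ℕP.<⇒≢ (subst₂ ℕ._<_ (ℕP.*-identityˡ q) (ℕP.*-identityʳ p) q<p) (sym p≡q)
    where
    p≡q : p ≡ q
    p≡q = ℤP.+-injective (ℤP.i-j≡0⇒i≡j (+ p) (+ q) (begin
      + p ℤ.- + q
        ≡⟨ cong₂ (λ a b → a ℤ.+ ℤ.- b) (sym U≡p) (trans (sym (ℤP.*-identityˡ (+ q))) (cong (+ 1 ℤ.*_) (sym V≡q))) ⟩
      atOne (U +E -E (var i *E V))   ≡⟨ atOne-cong U≈tV ⟩
      + 0 ∎))
      where open ≡-Reasoning

  vars : Fin n → F
  vars i = var i , 1E

  linked⇒notSeedCycle : ∀ B k ks → Linked (mutMat k B) k ks → NotSeedCycle B (k ∷ ks)
  linked⇒notSeedCycle B k ks linked x free y same =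
    aboveOne⇒≉var i (mutSeedSeq-valueAtOne (k ∷ ks) vars y B (λ _ → 1ʳ) (λ _ → valueAtOne refl refl) i) 1<r
      (FreeGenerating.algIndep free _ (⇝xᵢ⇒root (mutSeedSeq-⇝ (k ∷ ks) B vars⇝x (λ _ → refl) i) (proj₁ same i)))
    where
    open Evaluation x
    i = proj₁ (mutClSeqʳ-ones-aboveOne B k ks linked)
    1<r = proj₂ (mutClSeqʳ-ones-aboveOne B k ks linked)
    vars⇝x : ∀ i → vars i ⇝ x i
    vars⇝x i = prop 1E (*comm _ _) (*comm _ _)


-- The explicit family

res : ∀ {d} → Mat (suc d) → Mat d
res M i j = M (inject₁ i) (inject₁ j)

res-mutMat : ∀ {d} (M : Mat (suc d)) k → res (mutMat (inject₁ k) M) ≐ mutMat k (res M)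
res-mutMat M k = ≐-sym (mutMat-cases k (res M) (res (mutMat (inject₁ k) M))
  (λ j → sym (mutMat-row (inject₁ k) M (inject₁ j)))
  (λ i _ → sym (mutMat-col (inject₁ k) M (inject₁ i)))
  (λ i j i≢k j≢k → sym (mutMat-off (inject₁ k) M (λ e → i≢k (inject₁-injective e)) (λ e → j≢k (inject₁-injective e)))))

Linked-inject₁ : ∀ {d} (M : Mat (suc d)) j ks → Linked (res M) j ks → Linked M (inject₁ j) (map inject₁ ks)
Linked-inject₁ M j [] _ = tt
Linked-inject₁ M j (k ∷ ks) (j≢k , 2≤bjk , linked) =
  (λ e → j≢k (inject₁-injective e)) , 2≤bjk ,
  Linked-inject₁ (mutMat (inject₁ k) M) k ks (Linked-cong k ks (≐-sym (res-mutMat M k)) linked)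

Linked-inject₁-after : ∀ {d} (M : Mat (suc d)) j' j k ks → j' ≢ inject₁ k → 2 ≤ ∣ M j' (inject₁ k) ∣ →
  Linked (res M) j (k ∷ ks) → Linked M j' (map inject₁ (k ∷ ks))
Linked-inject₁-after M j' j k ks j'≢k 2≤bj'k (_ , _ , linked) =
  j'≢k , 2≤bj'k , Linked-inject₁ (mutMat (inject₁ k) M) k ks (Linked-cong k ks (≐-sym (res-mutMat M k)) linked)

toℕ-reverse-allFin : ∀ d → map toℕ (reverse (allFin d)) ≡ downFrom d
toℕ-reverse-allFin d = begin
  map toℕ (reverse (allFin d)) ≡⟨ List.reverse-map toℕ (allFin d) ⟩
  reverse (map toℕ (allFin d)) ≡⟨ cong reverse (List.map-tabulate {n = d} (λ i → i) toℕ) ⟩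
  reverse (tabulate {n = d} toℕ) ≡⟨ cong reverse (tabulate-toℕ d (λ i → i)) ⟩
  reverse (upTo d)             ≡⟨ List.reverse-upTo d ⟩
  downFrom d                   ∎
  where
  open ≡-Reasoning
  tabulate-toℕ : ∀ d (g : ℕ → ℕ) → tabulate {n = d} (λ i → g (toℕ i)) ≡ applyUpTo g d
  tabulate-toℕ zero g = refl
  tabulate-toℕ (suc d) g = cong (g 0 ∷_) (tabulate-toℕ d (λ z → g (suc z)))

lastOr-downFrom : ∀ {d} t (ks : List (Fin d)) j → map toℕ ks ≡ downFrom (suc t) → toℕ (lastOr j ks) ≡ 0
lastOr-downFrom zero (k ∷ []) j e = List.∷-injectiveˡ e
lastOr-downFrom (suc t) (k ∷ ks) j e = lastOr-downFrom t ks k (List.∷-injectiveʳ e)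

2≤⇒nonneg : ∀ {z} → + 2 ≤ℤ z → Σ ℕ λ a → z ≡ + a
2≤⇒nonneg (+≤+ {n = a} _) = a , refl

2≤⇒2≤∣∣ : ∀ {z} → + 2 ≤ℤ z → 2 ≤ ∣ z ∣
2≤⇒2≤∣∣ (+≤+ 2≤a) = 2≤a

module Sinks {d} (R : Mat d) (skew : SkewSym R) (up : ∀ i j → i < j → + 2 ≤ℤ R i j) where

  below : ℕ → Fin d → Bool
  below t i = does (toℕ i ℕ.<? t)

  flip : Bool → ℤ → ℤ
  flip false z = z
  flip true z = ℤ.- z

  -- R with the arrows between {i | i < t} and its complement reversed: the quiver reached
  -- from R by mutating at d-1, d-2, …, t, each of which is a sink when it is mutated at.
  reversed : ℕ → Mat d
  reversed t i j = flip (below t i xor below t j) (R i j)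

  reversed-at : ∀ t i j {bi bj} → below t i ≡ bi → below t j ≡ bj → reversed t i j ≡ flip (bi xor bj) (R i j)
  reversed-at t i j refl refl = refl

  R-up : ∀ {i j} → toℕ i ℕ.< toℕ j → Σ ℕ λ a → R i j ≡ + a
  R-up {i} {j} i<j = 2≤⇒nonneg (up i j i<j)

  R-down : ∀ {i j} → toℕ j ℕ.< toℕ i → Σ ℕ λ a → R i j ≡ ℤ.- + a
  R-down {i} {j} j<i = proj₁ (R-up j<i) , trans (skew j i) (cong ℤ.-_ (proj₂ (R-up j<i)))

  ∣R∣≥2 : ∀ {i j} → i ≢ j → 2 ≤ ∣ R i j ∣
  ∣R∣≥2 {i} {j} i≢j with ℕP.<-cmp (toℕ i) (toℕ j)
  ... | tri< i<j _ _ = 2≤⇒2≤∣∣ (up i j i<j)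
  ... | tri≈ _ i≡j _ = contradiction (toℕ-injective i≡j) i≢j
  ... | tri> _ _ j<i = subst (2 ≤_) (sym (trans (cong ∣_∣ (skew j i)) (ℤP.∣-i∣≡∣i∣ (R j i)))) (2≤⇒2≤∣∣ (up j i j<i))

  ∣flip∣ : ∀ b z → ∣ flip b z ∣ ≡ ∣ z ∣
  ∣flip∣ false z = refl
  ∣flip∣ true z = ℤP.∣-i∣≡∣i∣ z

  ∣reversed∣≥2 : ∀ t {i j} → i ≢ j → 2 ≤ ∣ reversed t i j ∣
  ∣reversed∣≥2 t {i} {j} i≢j = subst (2 ≤_) (sym (∣flip∣ (below t i xor below t j) (R i j))) (∣R∣≥2 i≢j)

  R-diag : ∀ i → R i i ≡ + 0
  R-diag i = z≡-z⇒z≡0 (skew i i)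
    where
    z≡-z⇒z≡0 : ∀ {z} → z ≡ ℤ.- z → z ≡ + 0
    z≡-z⇒z≡0 {+ zero} _ = refl
    z≡-z⇒z≡0 {+ suc _} ()
    z≡-z⇒z≡0 { -[1+ _ ]} ()

  reversed-diag : ∀ t i → reversed t i i ≡ + 0
  reversed-diag t i with below t i
  ... | true = R-diag i
  ... | false = R-diag i

  neg-flip-xorˡ : ∀ b z → ℤ.- flip (true xor b) z ≡ flip (false xor b) z
  neg-flip-xorˡ true z = refl
  neg-flip-xorˡ false z = ℤP.neg-involutive z

  neg-flip-xorʳ : ∀ b z → ℤ.- flip (b xor true) z ≡ flip (b xor false) z
  neg-flip-xorʳ true z = refl
  neg-flip-xorʳ false z = ℤP.neg-involutive z

  below-< : ∀ {t i} → toℕ i ℕ.< t → below t i ≡ true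
  below-< {t} {i} = dec-true (toℕ i ℕ.<? t)

  below-≥ : ∀ {t i} → t ℕ.≤ toℕ i → below t i ≡ false
  below-≥ {t} {i} t≤i = dec-false (toℕ i ℕ.<? t) (ℕP.≤⇒≯ t≤i)

  reversed-d : reversed d ≐ R
  reversed-d i j = reversed-at d i j (below-< (toℕ<n i)) (below-< (toℕ<n j))

  module _ (m : Fin d) where
    private t = toℕ m

    m-below-suc : below (suc t) m ≡ true
    m-below-suc = below-< (ℕP.n<1+n t)

    m-not-below : below t m ≡ false
    m-not-below = below-≥ {i = m} ℕP.≤-refl

    below-suc : ∀ {i} → i ≢ m → below (suc t) i ≡ below t i
    below-suc {i} i≢m with ℕP.<-cmp (toℕ i) t
    ... | tri< i<t _ _ = trans (below-< (ℕP.m<n⇒m<1+n i<t)) (sym (below-< i<t))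
    ... | tri≈ _ i≡t _ = contradiction (toℕ-injective i≡t) i≢m
    ... | tri> _ _ t<i = trans (below-≥ t<i) (sym (below-≥ (ℕP.<⇒≤ t<i)))

    into-m : ∀ i → i ≢ m → Σ ℕ λ a → reversed (suc t) i m ≡ + a
    into-m i i≢m with ℕP.<-cmp (toℕ i) t
    ... | tri< i<t _ _ = proj₁ (R-up i<t) ,
      trans (reversed-at (suc t) i m (below-< (ℕP.m<n⇒m<1+n i<t)) m-below-suc) (proj₂ (R-up i<t))
    ... | tri≈ _ i≡t _ = contradiction (toℕ-injective i≡t) i≢m
    ... | tri> _ _ t<i = proj₁ (R-down t<i) ,
      trans (reversed-at (suc t) i m (below-≥ t<i) m-below-suc)
            (trans (cong ℤ.-_ (proj₂ (R-down t<i))) (ℤP.neg-involutive _))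

    out-of-m : ∀ j → j ≢ m → Σ ℕ λ a → reversed (suc t) m j ≡ ℤ.- + a
    out-of-m j j≢m with ℕP.<-cmp (toℕ j) t
    ... | tri< j<t _ _ = proj₁ (R-down j<t) ,
      trans (reversed-at (suc t) m j m-below-suc (below-< (ℕP.m<n⇒m<1+n j<t))) (proj₂ (R-down j<t))
    ... | tri≈ _ j≡t _ = contradiction (toℕ-injective j≡t) j≢m
    ... | tri> _ _ t<j = proj₁ (R-up t<j) ,
      trans (reversed-at (suc t) m j m-below-suc (below-≥ t<j)) (cong ℤ.-_ (proj₂ (R-up t<j)))

    reversed-mutMat : mutMat m (reversed (suc t)) ≐ reversed t
    reversed-mutMat = mutMat-cases m (reversed (suc t)) (reversed t) row col off
      where
      row : ∀ j → ℤ.- reversed (suc t) m j ≡ reversed t m j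
      row j with j ≟ m
      ... | yes refl = trans (cong ℤ.-_ (reversed-diag (suc t) m)) (sym (reversed-diag t m))
      ... | no j≢m = trans (cong ℤ.-_ (reversed-at (suc t) m j m-below-suc (below-suc j≢m)))
        (trans (neg-flip-xorˡ (below t j) (R m j)) (sym (reversed-at t m j m-not-below refl)))
      col : ∀ i → i ≢ m → ℤ.- reversed (suc t) i m ≡ reversed t i m
      col i i≢m = trans (cong ℤ.-_ (reversed-at (suc t) i m (below-suc i≢m) m-below-suc))
        (trans (neg-flip-xorʳ (below t i) (R i m)) (sym (reversed-at t i m refl m-not-below)))
      off : ∀ i j → i ≢ m → j ≢ m → reversed (suc t) i j ℤ.+ mutTerm (reversed (suc t) i m) (reversed (suc t) m j) ≡ reversed t i j
      off i j i≢m j≢m = trans (sym (mutMat-off m (reversed (suc t)) i≢m j≢m))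
        (trans (mutMat-sink m (reversed (suc t)) i≢m j≢m (into-m i i≢m) (out-of-m j j≢m))
               (cong₂ (λ bi bj → flip (bi xor bj) (R i j)) (below-suc i≢m) (below-suc j≢m)))

  reversed-mutMatSeq : ∀ t ks → map toℕ ks ≡ downFrom t → mutMatSeq ks (reversed t) ≐ reversed 0
  reversed-mutMatSeq zero [] _ = λ i j → refl
  reversed-mutMatSeq (suc t) (k ∷ ks) e with List.∷-injective e
  ... | refl , e' = ≐-trans (mutMatSeq-cong ks (reversed-mutMat k)) (reversed-mutMatSeq (toℕ k) ks e')

  reversed-linked : ∀ t ks j → map toℕ ks ≡ downFrom t → suc (toℕ j) ≢ t → Linked (reversed t) j ks
  reversed-linked zero [] j _ _ = tt
  reversed-linked (suc t) (k ∷ ks) j e 1+j≢1+t with List.∷-injective e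
  ... | refl , e' = j≢k , ∣reversed∣≥2 (suc t) j≢k ,
    Linked-cong k ks (≐-sym (reversed-mutMat k)) (reversed-linked (toℕ k) ks k e' ℕP.1+n≢n)
    where
    j≢k : j ≢ k
    j≢k refl = 1+j≢1+t refl

module SpecialSequence (p k : ℕ)
  (R : Mat (suc (suc (suc p)))) (skR : SkewSym R) (hR : ∀ i j → i < j → + 2 ≤ℤ R i j)
  (Q : Mat (suc (suc (suc (suc p))))) (skQ : SkewSym Q)
  (hQ : ∀ i j → Q (inject₁ i) (inject₁ j) ≡ mutMatSeq (rep21 zero (suc zero) (suc k)) R i j)
  (hN : ∀ i → + 2 ≤ℤ Q (inject₁ i) (fromℕ (suc (suc (suc p))))) where

  open Sinks R skR hR

  d : ℕ
  d = suc (suc (suc p))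

  N : Fin (suc d)
  N = fromℕ d

  seq₁₂ seqDown seq₂₁ : List (Fin d)
  seq₁₂ = rep21 (suc zero) zero (suc k)
  seqDown = reverse (allFin d)
  seq₂₁ = rep21 zero (suc zero) (suc k)

  specialSeq≡ : specialSeq p (suc k) ≡ N ∷ map inject₁ (seq₁₂ ++ seqDown ++ seq₂₁)
  specialSeq≡ = cong (N ∷_) (sym (begin
    map inject₁ (seq₁₂ ++ seqDown ++ seq₂₁)                            ≡⟨ List.map-++ inject₁ seq₁₂ (seqDown ++ seq₂₁) ⟩
    map inject₁ seq₁₂ ++ map inject₁ (seqDown ++ seq₂₁)
      ≡⟨ cong (map inject₁ seq₁₂ ++_) (List.map-++ inject₁ seqDown seq₂₁) ⟩
    map inject₁ seq₁₂ ++ map inject₁ seqDown ++ map inject₁ seq₂₁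
      ≡⟨ cong₂ (λ l l' → l ++ l' ++ map inject₁ seq₂₁)
               (map-rep21 inject₁ (suc zero) zero (suc k)) (List.reverse-map inject₁ (allFin d)) ⟩
    rep12 zero (suc zero) (suc k) ++ reverse (map inject₁ (allFin d)) ++ map inject₁ seq₂₁
      ≡⟨ cong (λ l → rep12 zero (suc zero) (suc k) ++ reverse (map inject₁ (allFin d)) ++ l)
              (map-rep21 inject₁ zero (suc zero) (suc k)) ⟩
    rep12 zero (suc zero) (suc k) ++ reverse (map inject₁ (allFin d)) ++ rep21 zero (suc zero) (suc k) ∎))
    where open ≡-Reasoning

  Q₁ : Mat (suc d)
  Q₁ = mutMat N Q

  inject₁≢N : ∀ i → inject₁ i ≢ N
  inject₁≢N i e = fromℕ≢inject₁ (sym e)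

  into-N : ∀ i → Σ ℕ λ a → Q (inject₁ i) N ≡ + a
  into-N i = 2≤⇒nonneg (hN i)

  out-of-N : ∀ j → Σ ℕ λ a → Q N (inject₁ j) ≡ ℤ.- + a
  out-of-N j = proj₁ (into-N j) , trans (skQ (inject₁ j) N) (cong ℤ.-_ (proj₂ (into-N j)))

  res-Q₁ : res Q₁ ≐ mutMatSeq seq₂₁ R
  res-Q₁ i j = trans (mutMat-sink N Q (inject₁≢N i) (inject₁≢N j) (into-N i) (out-of-N j)) (hQ i j)

  after-seq₁₂ : mutMatSeq seq₁₂ (res Q₁) ≐ R
  after-seq₁₂ = ≐-trans (mutMatSeq-cong seq₁₂ res-Q₁)
    (subst (λ l → mutMatSeq l (mutMatSeq seq₂₁ R) ≐ R) (reverse-rep21 zero (suc zero) (suc k)) (mutMatSeq-reverse seq₂₁ R))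

  after-seqDown : mutMatSeq seqDown R ≐ reversed 0
  after-seqDown = ≐-trans (mutMatSeq-cong seqDown (≐-sym reversed-d)) (reversed-mutMatSeq d seqDown (toℕ-reverse-allFin d))

  linked-seq₁₂ : Linked (res Q₁) (suc zero) seq₁₂
  linked-seq₁₂ = Linked-rep21 (suc zero) zero (suc k) (res Q₁) (λ ())
    (joined (inj₂ refl) (inj₁ refl) (λ ())) (joined (inj₁ refl) (inj₂ refl) (λ ()))
    where
    joined : ∀ {i j} → zero ≡ i ⊎ zero ≡ j → suc zero ≡ i ⊎ suc zero ≡ j → i ≢ j → 2 ≤ ∣ res Q₁ i j ∣
    joined 0∈ 1∈ i≢j =
      subst (2 ≤_) (sym (trans (cong ∣_∣ (res-Q₁ _ _)) (∣mutMatSeq-rep21∣ zero (suc zero) (suc k) R 0∈ 1∈))) (∣R∣≥2 i≢j)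

  linked-seqDown : Linked R (suc zero) seqDown
  linked-seqDown = Linked-cong (suc zero) seqDown reversed-d (reversed-linked d seqDown (suc zero) (toℕ-reverse-allFin d) (λ ()))

  linked-seq₂₁ : Linked (reversed 0) zero seq₂₁
  linked-seq₂₁ = Linked-rep21 zero (suc zero) (suc k) (reversed 0) (λ ()) (∣reversed∣≥2 0 (λ ())) (∣reversed∣≥2 0 (λ ()))

  linked-restricted : Linked (res Q₁) (suc zero) (seq₁₂ ++ seqDown ++ seq₂₁)
  linked-restricted =
    Linked-++ (res Q₁) (suc zero) seq₁₂ (seqDown ++ seq₂₁) linked-seq₁₂ after-seq₁₂ (lastOr-rep21 (suc zero) zero k (suc zero))
      (Linked-++ R (suc zero) seqDown seq₂₁ linked-seqDown after-seqDown last-seqDown linked-seq₂₁)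
    where
    last-seqDown : lastOr (suc zero) seqDown ≡ zero
    last-seqDown = toℕ-injective (lastOr-downFrom (suc (suc p)) seqDown (suc zero) (toℕ-reverse-allFin d))

  linked : Linked Q₁ N (map inject₁ (seq₁₂ ++ seqDown ++ seq₂₁))
  linked = Linked-inject₁-after Q₁ N (suc zero) zero _ (λ e → inject₁≢N zero (sym e)) 2≤∣Q₁N0∣ linked-restricted
    where
    2≤∣Q₁N0∣ : 2 ≤ ∣ Q₁ N (inject₁ zero) ∣
    2≤∣Q₁N0∣ = subst (2 ≤_) (sym (trans (∣mutMat-row∣ N Q zero) (trans (cong ∣_∣ (skQ zero N)) (ℤP.∣-i∣≡∣i∣ (Q zero N)))))
                     (2≤⇒2≤∣∣ (hN zero))


largeWeightCycle⇒notSeedCycle : ∀ {c ℓ} (P : Semifield c ℓ) n (B : Mat n) is →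
  IsMutationCycle B is → AlongSeq LargeWeights B is → Field.NotSeedCycle P n B is
largeWeightCycle⇒notSeedCycle P n B [] ()
largeWeightCycle⇒notSeedCycle P n B (i ∷ is) (distinct , _ , _) (_ , along) =
  linked⇒notSeedCycle P n B i is (largeWeights⇒linked (mutMat i B) i is i distinct along)

theorem9p1 : ∀ {c ℓ : Level} (P : Semifield c ℓ) →
    (∀ (n : ℕ) → 2 ≤ n → (B : Mat n) → SkewSym B → (is : List (Fin n)) →
      IsMutationCycle B is → AlongSeq LargeWeights B is →
      Field.NotSeedCycle P n B is)
    ×
    (∀ (p k : ℕ) → k > 0 →
      (R : Mat (suc (suc (suc p)))) → SkewSym R → (∀ i j → i < j → + 2 ≤ℤ R i j) →
      (Q : Mat (suc (suc (suc (suc p))))) → SkewSym Q →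
      (∀ i j → Q (inject₁ i) (inject₁ j) ≡ mutMatSeq (rep21 zero (suc zero) k) R i j) →
      (∀ i → + 2 ≤ℤ Q (inject₁ i) (fromℕ (suc (suc (suc p))))) →
      Field.NotSeedCycle P (suc (suc (suc (suc p)))) Q (specialSeq p k))
theorem9p1 P =
  (λ n _ B _ → largeWeightCycle⇒notSeedCycle P n B) ,
  λ { p zero ()
    ; p (suc k) _ R skR hR Q skQ hQ hN → let open SpecialSequence p k R skR hR Q skQ hQ hN in
        subst (Field.NotSeedCycle P (suc d) Q) (sym specialSeq≡) (linked⇒notSeedCycle P (suc d) Q N _ linked) }
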